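{- Let $n\geq3$ and let $A\subseteq X_n$ be a finite down-set with $\mathcal{C}^{\mathrm{bal}}_i(A)=A$ for all $i\in\{1,\dots,n\}$. Suppose $x,y\in X_n$ with $x<y$ in the balanced order, $x\notin A$ and $y\in A$. Then (i) $x$ has exactly one coordinate equal to zero; (ii) if $x_j=y_j$ for some $j$, then $x_j=y_j=0$ and $y$ has at least one other coordinate equal to zero.
   Context: $X_n=\{x\in\mathbb{Z}_{\ge0}^n: x_k=0\text{ for some } k\}$. A set $A\subseteq X_n$ is a down-set if whenever $x\in\mathbb{Z}_{\ge0}^n$, $y\in A$ and $x_k\le y_k$ for all $k$, then $x\in A$. Balanced order on $X_n$: for distinct $x,y$ let $T=\{k:x_k\ne y_k\}$, $M_x=\max_{k\in T}x_k$, $M_y=\max_{k\in T}y_k$; $x<y$ iff $M_x<M_y$, or $M_x=M_y$ and $\max\{k\in T:x_k=M_x\}<\max\{k\in T:y_k=M_y\}$; initial segments are sets of the smallest elements. For finite $A\subseteq X_n$ and $a\in\mathbb{Z}_{\ge0}$, let $L^i_a(A)=\{(x_1,\dots,x_{i-1},x_{i+1},\dots,x_n)\in X_{n-1}:(x_1,\dots,x_{i-1},a,x_{i+1},\dots,x_n)\in A\}$ and $K^i(A)=\{(x_1,\dots,x_{i-1},x_{i+1},\dots,x_n)\in\mathbb{Z}_{>0}^{n-1}:(x_1,\dots,x_{i-1},0,x_{i+1},\dots,x_n)\in A\}$. Order $\mathbb{Z}_{>0}^{n-1}$ by $u\prec v$ iff inserting $0$ at position $i$ into $u$ and $v$ gives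 vectors with the first smaller in the balanced order on $X_n$. The balanced-$i$-compression $\mathcal{C}^{\mathrm{bal}}_i(A)$ is the subset $A'\subseteq X_n$ with $L^i_a(A')$ the initial segment of the balanced order on $X_{n-1}$ of size $|L^i_a(A)|$ for each $a$, and $K^i(A')$ the first $|K^i(A)|$ elements of $(\mathbb{Z}_{>0}^{n-1},\prec)$. -}

module Defs where

open import Data.Nat using (ℕ; zero; suc; _⊔_; _<_; _≡ᵇ_; _≟_; _<?_)
open import Data.Bool using (Bool; not)
open import Data.Fin using (Fin; toℕ)
open import Data.List using (List; foldr; map; filter; filterᵇ; length; allFin)
open import Data.List.Membership.Propositional using (_∈_)
open import Data.Vec using (Vec; lookup; removeAt; insertAt)
import Data.Vec.Relation.Unary.Any as VAny
import Data.Vec.Relation.Unary.All as VAll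
open import Data.Product using (_×_; ∃; _,_)
open import Data.Sum using (_⊎_)
open import Relation.Nullary using (¬_)
open import Relation.Nullary.Decidable using (_×-dec_)
open import Relation.Binary.PropositionalEquality using (_≡_; _≢_)

Pt : ℕ → Set
Pt m = Vec ℕ m

InX : ∀ {m} → Pt m → Set
InX x = VAny.Any (_≡ 0) x

inX? : ∀ {m} (x : Pt m) → Relation.Nullary.Dec (InX x)
inX? x = VAny.any? (λ v → v ≟ 0) x

Pos : ∀ {m} → Pt m → Set
Pos x = VAll.All (0 <_) x

pos? : ∀ {m} (x : Pt m) → Relation.Nullary.Dec (Pos x)
pos? x = VAll.all? (λ v → 0 <? v) x

diffIdx : ∀ {m} → Pt m → Pt m → List (Fin m)
diffIdx {m} x y = filterᵇ (λ k → not (lookup x k ≡ᵇ lookup y k)) (allFin m)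

maxT : ∀ {m} → Pt m → Pt m → ℕ
maxT x y = foldr _⊔_ 0 (map (lookup x) (diffIdx x y))

-- 1 + max { k ∈ T : x_k = M_x }  (indices shifted by one; T nonempty for x ≠ y)
lastIdx : ∀ {m} → Pt m → Pt m → ℕ
lastIdx x y =
  foldr _⊔_ 0 (map (λ k → suc (toℕ k))
    (filterᵇ (λ k → lookup x k ≡ᵇ maxT x y) (diffIdx x y)))

_<b_ : ∀ {m} → Pt m → Pt m → Set
x <b y = x ≢ y × (maxT x y < maxT y x ⊎ (maxT x y ≡ maxT y x × lastIdx x y < lastIdx y x))

-- Finite subsets of X_n are duplicate-free lists of points.

DownSet : ∀ {n} → List (Pt n) → Set
DownSet {n} A = ∀ (x y : Pt n) → y ∈ A → (∀ k → lookup x k Data.Nat.≤ lookup y k) → x ∈ A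

sliceL : ∀ {m} → Fin (suc m) → ℕ → List (Pt (suc m)) → List (Pt m)
sliceL i a A =
  map (λ x → removeAt x i)
    (filter (λ x → (lookup x i ≟ a) ×-dec inX? (removeAt x i)) A)

sliceK : ∀ {m} → Fin (suc m) → List (Pt (suc m)) → List (Pt m)
sliceK i A =
  map (λ x → removeAt x i)
    (filter (λ x → (lookup x i ≟ 0) ×-dec pos? (removeAt x i)) A)

_≺[_]_ : ∀ {m} → Pt m → Fin (suc m) → Pt m → Set
u ≺[ i ] v = insertAt u i 0 <b insertAt v i 0

IsBalInitSeg : ∀ {m} → ℕ → List (Pt m) → Set
IsBalInitSeg {m} k S =
  length S ≡ k
  × (∀ v → v ∈ S → InX v)
  × (∀ (u v : Pt m) → InX u → u <b v → v ∈ S → u ∈ S)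

IsPosInitSeg : ∀ {m} → Fin (suc m) → ℕ → List (Pt m) → Set
IsPosInitSeg {m} i k S =
  length S ≡ k
  × (∀ v → v ∈ S → Pos v)
  × (∀ (u v : Pt m) → Pos u → u ≺[ i ] v → v ∈ S → u ∈ S)

-- A' = C^bal_i(A): A' ⊆ X_n, each L^i_a(A') is the initial segment of size
-- |L^i_a(A)|, and K^i(A') is the initial segment of size |K^i(A)|.
-- (Every point of X_n lies in exactly one L^i_a or K^i slice, so this
-- determines A' uniquely.)
IsBalCompression : ∀ {m} → Fin (suc m) → List (Pt (suc m)) → List (Pt (suc m)) → Set
IsBalCompression i A A' =
  (∀ a → IsBalInitSeg (length (sliceL i a A)) (sliceL i a A'))
  × IsPosInitSeg i (length (sliceK i A)) (sliceK i A')

module Submission where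

-- The balanced order has a pivot description: x < y iff at some position p where x and y
-- differ, (y_p, p) lies lexicographically above (x_t, t) for every position t where they
-- differ. A pivot survives deleting a coordinate on which x and y agree, and lowering to 0
-- coordinates of y other than p on which x is 0 or differs from y. So if some w ≤ y (hence
-- w ∈ A, A being a down-set) lies above x and agrees with x at a coordinate j, then x and w
-- lie in a common slice L^j_a or K^j, and compression puts x into A. If x had two zeros,
-- lowering one or two coordinates of y yields such a w (a third coordinate is needed when the
-- pivot sits on a zero of x); part (ii) is the same argument with w = y.

open import Defs
open import Data.Nat using (ℕ; suc; _≤_; _<_; _⊔_; z≤n; s≤s; _≡ᵇ_; _≟_)
open import Data.Nat.Properties
open import Data.Bool using (true; false; not; T)
open import Data.Unit using (tt)
open import Data.Fin as Fin using (Fin; toℕ; punchIn; punchOut)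
import Data.Fin.Properties as Finₚ
open import Data.Fin.Patterns using (0F; 1F; 2F)
open import Data.List using (List; []; _∷_; foldr; map; filter; allFin)
open import Data.List.Membership.Propositional using (_∈_; _∉_)
open import Data.List.Membership.Propositional.Properties
  using (∈-map⁺; ∈-map⁻; ∈-filter⁺; ∈-filter⁻; ∈-allFin)
open import Data.List.Relation.Unary.Any using (here; there)
open import Data.List.Relation.Unary.All using (All)
open import Data.List.Relation.Unary.Unique.Propositional using (Unique)
open import Data.Vec using (lookup; removeAt; insertAt; _[_]≔_; tabulate)
open import Data.Vec.Properties
  using (tabulate∘lookup; tabulate-cong; insertAt-punchIn; insertAt-removeAt;
         removeAt-punchOut; lookup∘update; lookup∘update′)
import Data.Vec.Relation.Unary.Any as VAny
open import Data.Vec.Relation.Unary.Any.Properties using (lookup-index)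
open import Data.Vec.Relation.Unary.All.Properties using (lookup⁻)
open import Data.Vec.Membership.Propositional.Properties using (∈-lookup)
open import Data.Product using (_×_; ∃; _,_; proj₁; proj₂)
open import Data.Product.Relation.Binary.Lex.Strict using (×-Lex)
import Data.Sum as Sum
open import Data.Sum using (_⊎_; inj₁; inj₂)
open import Function using (_∘_; id)
open import Data.Empty using (⊥; ⊥-elim)
open import Relation.Nullary using (¬_; yes; no; contradiction)
open import Relation.Nullary.Decidable using (decidable-stable)
open import Relation.Nullary.Decidable.Core using (T?)
open import Level using (0ℓ)
open import Relation.Unary using (Pred; Decidable)
open import Relation.Binary.PropositionalEquality

module _ {A : Set} (f : A → ℕ) where

  ⊔-map-upper : ∀ {a} xs → a ∈ xs → f a ≤ foldr _⊔_ 0 (map f xs)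
  ⊔-map-upper (a ∷ xs) (here refl) = m≤m⊔n (f a) _
  ⊔-map-upper (a ∷ xs) (there a∈) = ≤-trans (⊔-map-upper xs a∈) (m≤n⊔m (f a) _)

  ⊔-map-least : ∀ {b} xs → (∀ {a} → a ∈ xs → f a ≤ b) → foldr _⊔_ 0 (map f xs) ≤ b
  ⊔-map-least []       _ = z≤n
  ⊔-map-least (a ∷ xs) h = ⊔-lub (h (here refl)) (⊔-map-least xs (h ∘ there))

  ⊔-map-attained : ∀ {a₀} xs → a₀ ∈ xs → ∃ λ a → a ∈ xs × f a ≡ foldr _⊔_ 0 (map f xs)
  ⊔-map-attained (a ∷ []) _ = a , here refl , sym (⊔-identityʳ (f a))
  ⊔-map-attained (a ∷ xs@(_ ∷ _)) _
    with ⊔-map-attained xs (here refl) | ⊔-sel (f a) (foldr _⊔_ 0 (map f xs))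
  ... | _              | inj₁ left  = a , here refl , sym left
  ... | b , b∈ , fb≡M  | inj₂ right = b , there b∈ , trans fb≡M (sym right)

≢⇒T-not-≡ᵇ : ∀ {a b} → a ≢ b → T (not (a ≡ᵇ b))
≢⇒T-not-≡ᵇ {a} {b} a≢b with a ≡ᵇ b in eq
... | true  = a≢b (≡ᵇ⇒≡ a b (subst T (sym eq) tt))
... | false = tt

T-not-≡ᵇ⇒≢ : ∀ {a b} → T (not (a ≡ᵇ b)) → a ≢ b
T-not-≡ᵇ⇒≢ {a} t refl with a ≡ᵇ a | ≡⇒≡ᵇ a a refl
... | true | _ = t

Differ : ∀ {n} → Pt n → Pt n → Fin n → Set
Differ x y t = lookup x t ≢ lookup y t

≢⇒∃-differ : ∀ {n} {x y : Pt n} → x ≢ y → ∃ (Differ x y)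
≢⇒∃-differ {n} {x} {y} x≢y =
  Finₚ.¬∀⟶∃¬ n _ (λ t → lookup x t ≟ lookup y t) (x≢y ∘ lookup-ext)
  where
  lookup-ext : (∀ t → lookup x t ≡ lookup y t) → x ≡ y
  lookup-ext same = begin
    x                   ≡⟨ tabulate∘lookup x ⟨
    tabulate (lookup x) ≡⟨ tabulate-cong same ⟩
    tabulate (lookup y) ≡⟨ tabulate∘lookup y ⟩
    y                   ∎
    where open ≡-Reasoning

module _ {n} (x y : Pt n) where

  ∈-diffIdx⁺ : ∀ {t} → Differ x y t → t ∈ diffIdx x y
  ∈-diffIdx⁺ d = ∈-filter⁺ (T? ∘ _) (∈-allFin _) (≢⇒T-not-≡ᵇ d)

  ∈-diffIdx⁻ : ∀ {t} → t ∈ diffIdx x y → Differ x y t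
  ∈-diffIdx⁻ t∈ = T-not-≡ᵇ⇒≢ (proj₂ (∈-filter⁻ (T? ∘ _) {xs = allFin n} t∈))

  maxT-upper : ∀ {t} → Differ x y t → lookup x t ≤ maxT x y
  maxT-upper d = ⊔-map-upper (lookup x) (diffIdx x y) (∈-diffIdx⁺ d)

  maxT-least : ∀ {b} → (∀ t → Differ x y t → lookup x t ≤ b) → maxT x y ≤ b
  maxT-least h = ⊔-map-least (lookup x) (diffIdx x y) (h _ ∘ ∈-diffIdx⁻)

  private
    top = filter (T? ∘ λ k → lookup x k ≡ᵇ maxT x y) (diffIdx x y)

    ∈-top⁺ : ∀ {t} → Differ x y t → lookup x t ≡ maxT x y → t ∈ top
    ∈-top⁺ d xt≡M = ∈-filter⁺ (T? ∘ _) (∈-diffIdx⁺ d) (≡⇒≡ᵇ _ _ xt≡M)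

    ∈-top⁻ : ∀ {t} → t ∈ top → Differ x y t × lookup x t ≡ maxT x y
    ∈-top⁻ t∈ =
      let t∈T , is-max = ∈-filter⁻ (T? ∘ _) {xs = diffIdx x y} t∈
      in ∈-diffIdx⁻ t∈T , ≡ᵇ⇒≡ _ _ is-max

  lastIdx-upper : ∀ {t} → Differ x y t → lookup x t ≡ maxT x y → suc (toℕ t) ≤ lastIdx x y
  lastIdx-upper d xt≡M = ⊔-map-upper (suc ∘ toℕ) top (∈-top⁺ d xt≡M)

  lastIdx-least : ∀ {b} → (∀ t → Differ x y t → lookup x t ≡ maxT x y → suc (toℕ t) ≤ b) →
                  lastIdx x y ≤ b
  lastIdx-least h = ⊔-map-least (suc ∘ toℕ) top λ t∈ → let d , xt≡M = ∈-top⁻ t∈ in h _ d xt≡M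

  lastIdx-attained : ∀ {t₀} → Differ x y t₀ →
    ∃ λ t → Differ x y t × lookup x t ≡ maxT x y × suc (toℕ t) ≡ lastIdx x y
  lastIdx-attained d₀ =
    let t₁ , t₁∈ , xt₁≡M = ⊔-map-attained (lookup x) (diffIdx x y) (∈-diffIdx⁺ d₀)
        t , t∈ , st≡L   = ⊔-map-attained (suc ∘ toℕ) top (∈-top⁺ (∈-diffIdx⁻ t₁∈) xt₁≡M)
        d , xt≡M        = ∈-top⁻ t∈
    in t , d , xt≡M , st≡L

_⊏_ : ℕ × ℕ → ℕ × ℕ → Set
_⊏_ = ×-Lex _≡_ _<_ _<_

entry : ∀ {n} → Pt n → Fin n → ℕ × ℕ
entry x t = lookup x t , toℕ t

record IsPivot {n} (x y : Pt n) (p : Fin n) : Set where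
  constructor isPivot
  field
    differs   : Differ x y p
    dominates : ∀ t → Differ x y t → entry x t ⊏ entry y p

Pivot : ∀ {n} → Pt n → Pt n → Set
Pivot x y = ∃ (IsPivot x y)

<b⇒pivot : ∀ {n} {x y : Pt n} → x <b y → Pivot x y
<b⇒pivot {x = x} {y} (x≢y , order)
  with lastIdx-attained y x (proj₂ (≢⇒∃-differ x≢y) ∘ sym)
... | p , dp , yp≡My , sp≡Ly = p , isPivot (dp ∘ sym) (dominated order)
  where
  dominated : maxT x y < maxT y x ⊎ (maxT x y ≡ maxT y x × lastIdx x y < lastIdx y x) →
              ∀ t → Differ x y t → entry x t ⊏ entry y p
  dominated o t d with o | m≤n⇒m<n∨m≡n (maxT-upper x y d)
  ... | inj₁ Mx<My | _ =
    inj₁ (≤-<-trans (maxT-upper x y d) (subst (maxT x y <_) (sym yp≡My) Mx<My))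
  ... | inj₂ (Mx≡My , _) | inj₁ xt<Mx =
    inj₁ (<-≤-trans xt<Mx (≤-reflexive (trans Mx≡My (sym yp≡My))))
  ... | inj₂ (Mx≡My , Lx<Ly) | inj₂ xt≡Mx =
    inj₂ (trans xt≡Mx (trans Mx≡My (sym yp≡My)) ,
          ≤-pred (≤-<-trans (lastIdx-upper x y d xt≡Mx)
                            (subst (lastIdx x y <_) (sym sp≡Ly) Lx<Ly)))

pivot⇒<b : ∀ {n} {x y : Pt n} → Pivot x y → x <b y
pivot⇒<b {x = x} {y} (p , isPivot dp dom) = dp ∘ cong (λ v → lookup v p) , order
  where
  Mx≤yp : maxT x y ≤ lookup y p
  Mx≤yp = maxT-least x y λ t d → Sum.[ <⇒≤ , ≤-reflexive ∘ proj₁ ] (dom t d)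
  yp≤My : lookup y p ≤ maxT y x
  yp≤My = maxT-upper y x (dp ∘ sym)
  order : maxT x y < maxT y x ⊎ (maxT x y ≡ maxT y x × lastIdx x y < lastIdx y x)
  order with m≤n⇒m<n∨m≡n (≤-trans Mx≤yp yp≤My)
  ... | inj₁ Mx<My = inj₁ Mx<My
  ... | inj₂ Mx≡My = inj₂ (Mx≡My , ≤-<-trans Lx≤p (lastIdx-upper y x (dp ∘ sym) yp≡My))
    where
    yp≡My : lookup y p ≡ maxT y x
    yp≡My = ≤-antisym yp≤My (subst (_≤ lookup y p) Mx≡My Mx≤yp)
    Lx≤p : lastIdx x y ≤ toℕ p
    Lx≤p = lastIdx-least x y λ t d xt≡Mx → Sum.[
      (λ xt<yp → contradiction (trans xt≡Mx (trans Mx≡My (sym yp≡My))) (<⇒≢ xt<yp)) ,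
      proj₂ ] (dom t d)

lookup-removeAt : ∀ {m} (x : Pt (suc m)) j t → lookup (removeAt x j) t ≡ lookup x (punchIn j t)
lookup-removeAt x j t = begin
  lookup (removeAt x j) t
    ≡⟨ insertAt-punchIn (removeAt x j) j (lookup x j) t ⟨
  lookup (insertAt (removeAt x j) j (lookup x j)) (punchIn j t)
    ≡⟨ cong (λ v → lookup v (punchIn j t)) (insertAt-removeAt x j) ⟩
  lookup x (punchIn j t)
    ∎
  where open ≡-Reasoning

removeAt-injective : ∀ {m} {x z : Pt (suc m)} j →
  lookup x j ≡ lookup z j → removeAt x j ≡ removeAt z j → x ≡ z
removeAt-injective {x = x} {z} j xj≡zj rx≡rz = begin
  x                                      ≡⟨ insertAt-removeAt x j ⟨
  insertAt (removeAt x j) j (lookup x j) ≡⟨ cong₂ (λ r v → insertAt r j v) rx≡rz xj≡zj ⟩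
  insertAt (removeAt z j) j (lookup z j) ≡⟨ insertAt-removeAt z j ⟩
  z                                      ∎
  where open ≡-Reasoning

punchIn-cancel-< : ∀ {n} i (j k : Fin n) → punchIn i j Fin.< punchIn i k → j Fin.< k
punchIn-cancel-< i j k lt = ≰⇒> λ k≤j → <⇒≱ lt (Finₚ.punchIn-mono-≤ i k j k≤j)

removeAt-pivot : ∀ {m} {x y : Pt (suc m)} j → lookup x j ≡ lookup y j →
  Pivot x y → Pivot (removeAt x j) (removeAt y j)
removeAt-pivot {x = x} {y} j xj≡yj (p , isPivot dp dom) = p′ , isPivot dp′ dom′
  where
  j≢p : j ≢ p
  j≢p refl = dp xj≡yj
  p′ = punchOut j≢p
  rx : lookup (removeAt x j) p′ ≡ lookup x p
  rx = removeAt-punchOut x j≢p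
  ry : lookup (removeAt y j) p′ ≡ lookup y p
  ry = removeAt-punchOut y j≢p
  dp′ : Differ (removeAt x j) (removeAt y j) p′
  dp′ eq = dp (trans (sym rx) (trans eq ry))
  dom′ : ∀ t → Differ (removeAt x j) (removeAt y j) t →
         entry (removeAt x j) t ⊏ entry (removeAt y j) p′
  dom′ t d rewrite lookup-removeAt x j t | lookup-removeAt y j t | ry
    with dom (punchIn j t) d
  ... | inj₁ lt        = inj₁ lt
  ... | inj₂ (eq , lt) = inj₂ (eq , punchIn-cancel-< j t p′ (subst (punchIn j t Fin.<_) p≡↑p′ lt))
    where
    p≡↑p′ : p ≡ punchIn j p′
    p≡↑p′ = sym (Finₚ.punchIn-punchOut j≢p)

removeAt-<b : ∀ {m} {x y : Pt (suc m)} j → lookup x j ≡ lookup y j →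
              x <b y → removeAt x j <b removeAt y j
removeAt-<b {x = x} {y} j xj≡yj x<y =
  pivot⇒<b (removeAt-pivot {x = x} {y} j xj≡yj (<b⇒pivot {x = x} {y} x<y))

update-zero-≤ : ∀ {n} (y : Pt n) k t → lookup (y [ k ]≔ 0) t ≤ lookup y t
update-zero-≤ y k t with t Fin.≟ k
... | yes refl = subst (_≤ lookup y t) (sym (lookup∘update k y 0)) z≤n
... | no t≢k   = ≤-reflexive (lookup∘update′ t≢k y 0)

update-zero-isPivot : ∀ {n} {x y : Pt n} {p} k → IsPivot x y p → k ≢ p →
                      lookup x k ≡ 0 ⊎ Differ x y k → IsPivot x (y [ k ]≔ 0) p
update-zero-isPivot {x = x} {y} {p} k (isPivot dp dom) k≢p xk =
  isPivot (λ eq → dp (trans eq yp)) dom′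
  where
  yp : lookup (y [ k ]≔ 0) p ≡ lookup y p
  yp = lookup∘update′ (k≢p ∘ sym) y 0
  differ : ∀ t → Differ x (y [ k ]≔ 0) t → Differ x y t
  differ t d with t Fin.≟ k
  ... | yes refl = Sum.[ (λ xk≡0 → ⊥-elim (d (trans xk≡0 (sym (lookup∘update k y 0))))) , id ] xk
  ... | no t≢k   = λ eq → d (trans eq (sym (lookup∘update′ t≢k y 0)))
  dom′ : ∀ t → Differ x (y [ k ]≔ 0) t → entry x t ⊏ entry (y [ k ]≔ 0) p
  dom′ t d = subst (λ v → entry x t ⊏ (v , toℕ p)) (sym yp) (dom t (differ t d))

InX⇒zero : ∀ {n} {x : Pt n} → InX x → ∃ λ k → lookup x k ≡ 0
InX⇒zero xX = VAny.index xX , lookup-index xX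

zero⇒InX : ∀ {n} {x : Pt n} k → lookup x k ≡ 0 → InX x
zero⇒InX {x = x} k xk≡0 = VAny.map (λ xk≡v → trans (sym xk≡v) xk≡0) (∈-lookup k x)

¬InX⇒Pos : ∀ {n} {x : Pt n} → ¬ InX x → Pos x
¬InX⇒Pos ¬xX = lookup⁻ λ k → n≢0⇒n>0 (¬xX ∘ zero⇒InX k)

removeAt-InX⁺ : ∀ {m} (x : Pt (suc m)) {j k} → j ≢ k → lookup x k ≡ 0 → InX (removeAt x j)
removeAt-InX⁺ x j≢k xk≡0 = zero⇒InX (punchOut j≢k) (trans (removeAt-punchOut x j≢k) xk≡0)

removeAt-InX⁻ : ∀ {m} (x : Pt (suc m)) j → InX (removeAt x j) → ∃ λ k → k ≢ j × lookup x k ≡ 0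
removeAt-InX⁻ x j rX =
  let t , rt≡0 = InX⇒zero rX
  in punchIn j t , Finₚ.punchInᵢ≢i j t , trans (sym (lookup-removeAt x j t)) rt≡0

¬removeAt-InX : ∀ {m} {x : Pt (suc m)} j → InX x → ¬ InX (removeAt x j) → lookup x j ≡ 0
¬removeAt-InX {x = x} j xX ¬rX with InX⇒zero xX
... | k , xk≡0 with j Fin.≟ k
...   | yes refl = xk≡0
...   | no j≢k   = contradiction (removeAt-InX⁺ x j≢k xk≡0) ¬rX

module _ {m} {A : List (Pt (suc m))} {j : Fin (suc m)} where

  private
    ∈-slice⁻ : ∀ {P : Pred (Pt (suc m)) 0ℓ} (P? : Decidable P) {x} →
      (∀ {z} → P z → lookup z j ≡ lookup x j) →
      removeAt x j ∈ map (λ z → removeAt z j) (filter P? A) → x ∈ A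
    ∈-slice⁻ P? same rx∈ with ∈-map⁻ _ rx∈
    ... | z , z∈ , rx≡rz with ∈-filter⁻ P? z∈
    ...   | z∈A , Pz = subst (_∈ A) (sym (removeAt-injective j (sym (same Pz)) rx≡rz)) z∈A

  ∈-sliceL⁺ : ∀ {z a} → z ∈ A → lookup z j ≡ a → InX (removeAt z j) → removeAt z j ∈ sliceL j a A
  ∈-sliceL⁺ z∈ zj≡a rX = ∈-map⁺ _ (∈-filter⁺ _ z∈ (zj≡a , rX))

  ∈-sliceL⁻ : ∀ {x a} → lookup x j ≡ a → removeAt x j ∈ sliceL j a A → x ∈ A
  ∈-sliceL⁻ xj≡a = ∈-slice⁻ _ λ (zj≡a , _) → trans zj≡a (sym xj≡a)

  ∈-sliceK⁺ : ∀ {z} → z ∈ A → lookup z j ≡ 0 → Pos (removeAt z j) → removeAt z j ∈ sliceK j A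
  ∈-sliceK⁺ z∈ zj≡0 rP = ∈-map⁺ _ (∈-filter⁺ _ z∈ (zj≡0 , rP))

  ∈-sliceK⁻ : ∀ {x} → lookup x j ≡ 0 → removeAt x j ∈ sliceK j A → x ∈ A
  ∈-sliceK⁻ xj≡0 = ∈-slice⁻ _ λ (zj≡0 , _) → trans zj≡0 (sym xj≡0)

  module _ (compressed : IsBalCompression j A A) {x w : Pt (suc m)} (w∈A : w ∈ A) (x<w : x <b w)
    where

    ∈-compressed-sliceL : lookup x j ≡ lookup w j →
                          InX (removeAt x j) → InX (removeAt w j) → x ∈ A
    ∈-compressed-sliceL xj≡wj xX wX =
      let _ , _ , closed = proj₁ compressed (lookup w j)
      in ∈-sliceL⁻ xj≡wj (closed _ _ xX (removeAt-<b j xj≡wj x<w) (∈-sliceL⁺ w∈A refl wX))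

    ∈-compressed-sliceK : lookup x j ≡ 0 → lookup w j ≡ 0 →
                          Pos (removeAt x j) → Pos (removeAt w j) → x ∈ A
    ∈-compressed-sliceK xj≡0 wj≡0 xP wP =
      let _ , _ , closed = proj₂ compressed
          x<w′ = subst₂ _<b_ (sym (reinsert xj≡0)) (sym (reinsert wj≡0)) x<w
      in ∈-sliceK⁻ xj≡0 (closed _ _ xP x<w′ (∈-sliceK⁺ w∈A wj≡0 wP))
      where
      reinsert : ∀ {z} → lookup z j ≡ 0 → insertAt (removeAt z j) j 0 ≡ z
      reinsert {z} zj≡0 = subst (λ v → insertAt (removeAt z j) j v ≡ z) zj≡0 (insertAt-removeAt z j)

third-index : ∀ {n} → 3 ≤ n → (j k : Fin n) → ∃ λ q → q ≢ j × q ≢ k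
third-index (s≤s (s≤s (s≤s _))) = λ where
  0F                    0F                    → 1F , (λ ()) , (λ ())
  0F                    1F                    → 2F , (λ ()) , (λ ())
  0F                    (Fin.suc (Fin.suc _)) → 1F , (λ ()) , (λ ())
  1F                    0F                    → 2F , (λ ()) , (λ ())
  (Fin.suc (Fin.suc _)) 0F                    → 1F , (λ ()) , (λ ())
  (Fin.suc _)           (Fin.suc _)           → 0F , (λ ()) , (λ ())

module _ {m} {A : List (Pt (suc m))} (down : DownSet A)
         (compressed : ∀ i → IsBalCompression i A A)
         (x y : Pt (suc m)) (x∉A : x ∉ A) (y∈A : y ∈ A) (x<y : x <b y) where

  private
    ¬sharedSliceL : ∀ w {c} → (∀ t → lookup w t ≤ lookup y t) → x <b w →
                    lookup x c ≡ lookup w c → InX (removeAt x c) → InX (removeAt w c) → ⊥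
    ¬sharedSliceL w w≤y x<w xc≡wc xX wX =
      x∉A (∈-compressed-sliceL (compressed _) (down _ y y∈A w≤y) x<w xc≡wc xX wX)

    -- w = y with coordinates k and r lowered to 0 agrees with x at k, and after deleting k
    -- the zero j of x and the zero r of w remain.
    ¬two-zeros-lowered : ∀ {p j k r} → IsPivot x y p → j ≢ k → lookup x j ≡ 0 → lookup x k ≡ 0 →
                         k ≢ p → r ≢ k → r ≢ p → lookup x r ≡ 0 ⊎ Differ x y r → ⊥
    ¬two-zeros-lowered {p} {j} {k} {r} piv j≢k xj≡0 xk≡0 k≢p r≢k r≢p xr =
      ¬sharedSliceL w w≤y (pivot⇒<b (p , w-pivot)) (trans xk≡0 (sym wk≡0))
        (removeAt-InX⁺ x (j≢k ∘ sym) xj≡0)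
        (removeAt-InX⁺ w (r≢k ∘ sym) (lookup∘update r (y [ k ]≔ 0) 0))
      where
      w = (y [ k ]≔ 0) [ r ]≔ 0
      w≤y : ∀ t → lookup w t ≤ lookup y t
      w≤y t = ≤-trans (update-zero-≤ (y [ k ]≔ 0) r t) (update-zero-≤ y k t)
      w-pivot : IsPivot x w p
      w-pivot = update-zero-isPivot r (update-zero-isPivot k piv k≢p (inj₁ xk≡0)) r≢p
                  (Sum.map₂ (λ dr eq → dr (trans eq (lookup∘update′ r≢k y 0))) xr)
      wk≡0 : lookup w k ≡ 0
      wk≡0 = trans (lookup∘update′ (r≢k ∘ sym) (y [ k ]≔ 0) 0) (lookup∘update k y 0)

    ¬two-zeros : ∀ {p j k} → IsPivot x y p → (∃ λ q → q ≢ j × q ≢ k) → j ≢ k →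
                 lookup x j ≡ 0 → lookup x k ≡ 0 → k ≢ p → ⊥
    ¬two-zeros {p} {j} {k} piv (q , q≢j , q≢k) j≢k xj≡0 xk≡0 k≢p with p Fin.≟ j
    ... | no p≢j = ¬two-zeros-lowered piv j≢k xj≡0 xk≡0 k≢p j≢k (p≢j ∘ sym) (inj₁ xj≡0)
    ... | yes refl with lookup x q ≟ lookup y q
    ...   | no xq≢yq = ¬two-zeros-lowered piv j≢k xj≡0 xk≡0 k≢p q≢k q≢j (inj₂ xq≢yq)
    ...   | yes xq≡yq =
      ¬sharedSliceL (y [ k ]≔ 0) (update-zero-≤ y k)
        (pivot⇒<b (p , update-zero-isPivot k piv k≢p (inj₁ xk≡0)))
        (trans xq≡yq (sym (lookup∘update′ q≢k y 0)))
        (removeAt-InX⁺ x q≢j xj≡0) (removeAt-InX⁺ (y [ k ]≔ 0) q≢k (lookup∘update k y 0))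

  at-most-one-zero : 3 ≤ suc m → ∀ {j k} → j ≢ k → lookup x j ≡ 0 → lookup x k ≡ 0 → ⊥
  at-most-one-zero 3≤n {j} {k} j≢k xj≡0 xk≡0 with <b⇒pivot {x = x} {y} x<y
  ... | p , piv with p Fin.≟ k
  ...   | no p≢k   = ¬two-zeros piv (third-index 3≤n j k) j≢k xj≡0 xk≡0 (p≢k ∘ sym)
  ...   | yes refl = ¬two-zeros piv (third-index 3≤n k j) (j≢k ∘ sym) xk≡0 xj≡0 j≢k

  unique-zero : 3 ≤ suc m → InX x → ∃ λ k → lookup x k ≡ 0 × (∀ j → lookup x j ≡ 0 → j ≡ k)
  unique-zero 3≤n xX =
    let k , xk≡0 = InX⇒zero xX
    in k , xk≡0 , λ j xj≡0 →
         decidable-stable (j Fin.≟ k) λ j≢k → at-most-one-zero 3≤n j≢k xj≡0 xk≡0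

  agreement-is-zero : 3 ≤ suc m → InX x → InX y → ∀ j → lookup x j ≡ lookup y j →
    lookup x j ≡ 0 × lookup y j ≡ 0 × (∃ λ k → k ≢ j × lookup y k ≡ 0)
  agreement-is-zero 3≤n xX yX j xj≡yj with inX? (removeAt x j) | inX? (removeAt y j)
  ... | yes rxX | yes ryX = ⊥-elim (¬sharedSliceL y (λ _ → ≤-refl) x<y xj≡yj rxX ryX)
  ... | yes rxX | no ¬ryX =
    let k , k≢j , xk≡0 = removeAt-InX⁻ x j rxX
    in ⊥-elim (at-most-one-zero 3≤n k≢j xk≡0 (trans xj≡yj (¬removeAt-InX j yX ¬ryX)))
  ... | no ¬rxX | yes ryX =
    let xj≡0 = ¬removeAt-InX j xX ¬rxX
    in xj≡0 , trans (sym xj≡yj) xj≡0 , removeAt-InX⁻ y j ryX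
  ... | no ¬rxX | no ¬ryX =
    ⊥-elim (x∉A (∈-compressed-sliceK (compressed j) y∈A x<y
                   (¬removeAt-InX j xX ¬rxX) (¬removeAt-InX j yX ¬ryX)
                   (¬InX⇒Pos ¬rxX) (¬InX⇒Pos ¬ryX)))

lemma11 : (m : ℕ) → 3 ≤ suc m
    → (A : List (Pt (suc m))) → Unique A → All InX A → DownSet A
    → (∀ (i : Fin (suc m)) → IsBalCompression i A A)
    → (x y : Pt (suc m)) → InX x → InX y → x <b y → x ∉ A → y ∈ A
    → (∃ λ k → lookup x k ≡ 0 × (∀ j → lookup x j ≡ 0 → j ≡ k))
      × (∀ j → lookup x j ≡ lookup y j
           → lookup x j ≡ 0 × lookup y j ≡ 0 × (∃ λ k → k ≢ j × lookup y k ≡ 0))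
lemma11 m 3≤n A _ _ down compressed x y xX yX x<y x∉A y∈A =
  unique-zero down compressed x y x∉A y∈A x<y 3≤n xX ,
  agreement-is-zero down compressed x y x∉A y∈A x<y 3≤n xX yX
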